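{- Let $L$ be a residuated lattice and $n\geq 1$ an integer. Every $n$-fold obstinate filter of $L$ is an $(n+1)$-fold obstinate filter of $L$.
   Context: A residuated lattice is an algebra $(L,\wedge,\vee,\otimes,\rightarrow,0,1)$ such that $(L,\wedge,\vee,0,1)$ is a bounded lattice, $(L,\otimes,1)$ is a commutative monoid, and $x\otimes y\leq z$ iff $x\leq y\rightarrow z$. A filter of $L$ is a nonempty subset closed under $\otimes$ and upward closed. For $x\in L$ and $k\geq1$, $x^k=x\otimes\cdots\otimes x$ ($k$ factors). For $k\geq 1$, a filter $F$ of $L$ is a $k$-fold obstinate filter if $0\notin F$ and for all $x,y\in L$ with $x\notin F$ and $y\notin F$ we have $x^k\rightarrow y\in F$ and $y^k\rightarrow x\in F$. -}

module Defs where

open import Level using (Level; suc; _⊔_)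
open import Data.Nat using (ℕ; zero) renaming (suc to sucℕ)
open import Data.Product using (_×_; ∃)
open import Relation.Nullary using (¬_)
open import Relation.Binary.PropositionalEquality using (_≡_)
import Algebra.Lattice.Structures as LS
open import Algebra.Structures using (IsCommutativeMonoid)

record ResiduatedLattice (c : Level) : Set (suc c) where
  infixr 7 _∧_
  infixr 6 _∨_
  infixr 8 _⊗_
  infixr 5 _⇒_
  infix 4 _≤_
  field
    Carrier   : Set c
    _∧_ _∨_ _⊗_ _⇒_ : Carrier → Carrier → Carrier
    𝟘 𝟙       : Carrier
    isLattice : LS.IsLattice {A = Carrier} _≡_ _∨_ _∧_
  _≤_ : Carrier → Carrier → Set c
  x ≤ y = x ∧ y ≡ x
  field
    𝟘-least   : ∀ x → 𝟘 ≤ x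
    𝟙-greatest : ∀ x → x ≤ 𝟙
    ⊗-isCommutativeMonoid : IsCommutativeMonoid _≡_ _⊗_ 𝟙
    residuation-to   : ∀ x y z → x ⊗ y ≤ z → x ≤ y ⇒ z
    residuation-from : ∀ x y z → x ≤ y ⇒ z → x ⊗ y ≤ z

module _ {c : Level} (L : ResiduatedLattice c) where
  open ResiduatedLattice L

  -- x ^ k = x ⊗ ⋯ ⊗ x (k factors), k ≥ 1; we set x ^ 0 = 1 (unused).
  _^_ : Carrier → ℕ → Carrier
  x ^ zero = 𝟙
  x ^ sucℕ zero = x
  x ^ sucℕ (sucℕ k) = x ⊗ (x ^ sucℕ k)

  record IsFilter {ℓ : Level} (F : Carrier → Set ℓ) : Set (c ⊔ ℓ) where
    field
      nonempty   : ∃ F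
      ⊗-closed   : ∀ {x y} → F x → F y → F (x ⊗ y)
      up-closed  : ∀ {x y} → x ≤ y → F x → F y

  record IsObstinate {ℓ : Level} (k : ℕ) (F : Carrier → Set ℓ) : Set (c ⊔ ℓ) where
    field
      isFilter : IsFilter F
      𝟘∉F      : ¬ F 𝟘
      obstinate : ∀ x y → ¬ F x → ¬ F y → F ((x ^ k) ⇒ y) × F ((y ^ k) ⇒ x)

-- Since x ^ (n + 1) = x ⊗ x ^ n ≤ x ^ n and implication is antitone in its
-- first argument, x ^ n ⇒ y ≤ x ^ (n + 1) ⇒ y; the filter is upward closed,
-- so the (n + 1)-fold obstinacy conditions follow from the n-fold ones.
module Submission where

open import Defs
open import Level using (Level)
open import Data.Nat using (ℕ; suc; s≤s)
import Data.Nat as ℕ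
open import Data.Product using (_,_)
open import Relation.Binary.PropositionalEquality using (sym; subst; subst₂)
open import Relation.Binary.Bundles using (Poset)
open import Algebra.Structures using (IsCommutativeMonoid)
open import Algebra.Lattice.Bundles using (Lattice)
import Algebra.Lattice.Properties.Lattice as LatticeProperties

module ResiduatedLatticeProperties {c : Level} (L : ResiduatedLattice c) where
  open ResiduatedLattice L
  open IsCommutativeMonoid ⊗-isCommutativeMonoid
    using () renaming (comm to ⊗-comm; identityˡ to ⊗-identityˡ)

  lattice : Lattice c c
  lattice = record { isLattice = isLattice }

  -- The library's natural order is x ≡ x ∧ y, the symmetric form of _≤_.
  module P = Poset (LatticeProperties.poset lattice)

  ≤-refl : ∀ x → x ≤ x
  ≤-refl x = sym P.refl

  ≤-trans : ∀ {x y z} → x ≤ y → y ≤ z → x ≤ z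
  ≤-trans p q = sym (P.trans (sym p) (sym q))

  ⊗-monoˡ-≤ : ∀ {a b} z → a ≤ b → a ⊗ z ≤ b ⊗ z
  ⊗-monoˡ-≤ {a} {b} z a≤b =
    residuation-from a z (b ⊗ z) (≤-trans a≤b (residuation-to b z (b ⊗ z) (≤-refl _)))

  x⊗y≤y : ∀ x y → x ⊗ y ≤ y
  x⊗y≤y x y = subst (x ⊗ y ≤_) (⊗-identityˡ y) (⊗-monoˡ-≤ y (𝟙-greatest x))

  modus-ponens : ∀ x y → (x ⇒ y) ⊗ x ≤ y
  modus-ponens x y = residuation-from (x ⇒ y) x y (≤-refl _)

  ⇒-antitoneˡ : ∀ {a b} y → a ≤ b → b ⇒ y ≤ a ⇒ y
  ⇒-antitoneˡ {a} {b} y a≤b = residuation-to (b ⇒ y) a y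
    (≤-trans (subst₂ _≤_ (⊗-comm a (b ⇒ y)) (⊗-comm b (b ⇒ y)) (⊗-monoˡ-≤ (b ⇒ y) a≤b))
             (modus-ponens b y))

  ^-suc-≤ : ∀ x k → 1 ℕ.≤ k → _^_ L x (suc k) ≤ _^_ L x k
  ^-suc-≤ x (suc k) (s≤s _) = x⊗y≤y x (_^_ L x (suc k))

  ⇒-^-suc : ∀ x y k → 1 ℕ.≤ k → _^_ L x k ⇒ y ≤ _^_ L x (suc k) ⇒ y
  ⇒-^-suc x y k 1≤k = ⇒-antitoneˡ y (^-suc-≤ x k 1≤k)

open import Data.Nat using (_≤_)

proposition8p4 : {c ℓ : Level} (L : ResiduatedLattice c) (n : ℕ) → 1 ≤ n →
    (F : ResiduatedLattice.Carrier L → Set ℓ) →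
    IsObstinate L n F → IsObstinate L (suc n) F
proposition8p4 L n 1≤n F isObstinate = record
  { isFilter  = isFilter
  ; 𝟘∉F       = 𝟘∉F
  ; obstinate = λ x y x∉F y∉F → let (xⁿ⇒y∈F , yⁿ⇒x∈F) = obstinate x y x∉F y∉F in
      up-closed (⇒-^-suc x y n 1≤n) xⁿ⇒y∈F , up-closed (⇒-^-suc y x n 1≤n) yⁿ⇒x∈F
  }
  where
    open IsObstinate isObstinate
    open IsFilter isFilter
    open ResiduatedLatticeProperties L
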